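{- Let $M\models{\rm PA}$ be uncountable, and let $\mathbb{Q}^M$ be the rational numbers as constructed inside $M$, with the order topology of its order. Then $\mathbb{Q}^M$ is not separable; indeed, it has an uncountable discrete subset, and it admits an uncountable family of pairwise disjoint nonempty open intervals.
   Context: ${\rm PA}$ is first-order Peano arithmetic. -}

module Defs where

open import Data.Nat using (ℕ; zero; suc)
open import Data.Product using (Σ; ∃; _×_; _,_; proj₁; proj₂)
open import Data.Sum using (_⊎_)
open import Data.Empty using (⊥)
open import Relation.Nullary using (¬_)
open import Relation.Binary.PropositionalEquality using (_≡_)

-- First-order language of arithmetic {0, S, +, ·, <}, de Bruijn variables

data Term : Set where
  var  : ℕ → Term
  zer  : Term
  succ : Term → Term
  _⊕_  : Term → Term → Term
  _⊗_  : Term → Term → Term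

data Formula : Set where
  ⊥'       : Formula
  _≐_ _≺_  : Term → Term → Formula
  _∧'_ _∨'_ _⇒'_ : Formula → Formula → Formula
  ∀' ∃'    : Formula → Formula

-- An L-structure (equality is interpreted as true equality ≡)
record Structure : Set₁ where
  field
    Carrier : Set
    z       : Carrier
    s       : Carrier → Carrier
    _+_ _*_ : Carrier → Carrier → Carrier
    _<_     : Carrier → Carrier → Set

module _ (M : Structure) where
  open Structure M

  Env : Set
  Env = ℕ → Carrier

  _∷ₑ_ : Carrier → Env → Env
  (a ∷ₑ ρ) zero    = a
  (a ∷ₑ ρ) (suc n) = ρ n

  ⟦_⟧ : Term → Env → Carrier
  ⟦ var n  ⟧ ρ = ρ n
  ⟦ zer    ⟧ ρ = z
  ⟦ succ t ⟧ ρ = s (⟦ t ⟧ ρ)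
  ⟦ t ⊕ u  ⟧ ρ = ⟦ t ⟧ ρ + ⟦ u ⟧ ρ
  ⟦ t ⊗ u  ⟧ ρ = ⟦ t ⟧ ρ * ⟦ u ⟧ ρ

  Sat : Formula → Env → Set
  Sat ⊥'       ρ = ⊥
  Sat (t ≐ u)  ρ = ⟦ t ⟧ ρ ≡ ⟦ u ⟧ ρ
  Sat (t ≺ u)  ρ = ⟦ t ⟧ ρ < ⟦ u ⟧ ρ
  Sat (φ ∧' ψ) ρ = Sat φ ρ × Sat ψ ρ
  Sat (φ ∨' ψ) ρ = Sat φ ρ ⊎ Sat ψ ρ
  Sat (φ ⇒' ψ) ρ = Sat φ ρ → Sat ψ ρ
  Sat (∀' φ)   ρ = (a : Carrier) → Sat φ (a ∷ₑ ρ)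
  Sat (∃' φ)   ρ = Σ Carrier λ a → Sat φ (a ∷ₑ ρ)

record IsPAModel (M : Structure) : Set where
  open Structure M
  field
    s≢z     : ∀ x → ¬ (s x ≡ z)
    s-inj   : ∀ x y → s x ≡ s y → x ≡ y
    +-z     : ∀ x → x + z ≡ x
    +-s     : ∀ x y → x + s y ≡ s (x + y)
    *-z     : ∀ x → x * z ≡ z
    *-s     : ∀ x y → x * s y ≡ (x * y) + x
    <-def₁  : ∀ x y → x < y → Σ Carrier λ w → x + s w ≡ y
    <-def₂  : ∀ x y w → x + s w ≡ y → x < y
    -- induction schema: for every formula φ (variable 0 is the induction
    -- variable, the others are parameters) and every parameter assignment
    induction : ∀ (φ : Formula) (ρ : Env M) →
      Sat M φ (_∷ₑ_ M z ρ) →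
      (∀ a → Sat M φ (_∷ₑ_ M a ρ) → Sat M φ (_∷ₑ_ M (s a) ρ)) →
      ∀ a → Sat M φ (_∷ₑ_ M a ρ)

Countable : (A : Set) → (A → A → Set) → Set
Countable A _≈_ = Σ (A → ℕ) λ f → ∀ x y → f x ≡ f y → x ≈ y

Uncountable : (A : Set) → (A → A → Set) → Set
Uncountable A _≈_ = ¬ Countable A _≈_

-- ℚ^M : the rationals constructed inside M.
-- (p , m , d) represents (p − m)/(d + 1) with p, m, d ∈ M.

module _ (M : Structure) where
  open Structure M

  record QM : Set where
    constructor frac
    field
      pos neg den : Carrier

  open QM

  -- equality of fractions: (p−m)(d'+1) = (p'−m')(d+1)
  _≈Q_ : QM → QM → Set
  x ≈Q y = (pos x * s (den y)) + (neg y * s (den x))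
         ≡ (pos y * s (den x)) + (neg x * s (den y))

  -- order of fractions: (p−m)(d'+1) < (p'−m')(d+1)
  _<Q_ : QM → QM → Set
  x <Q y = ((pos x * s (den y)) + (neg y * s (den x)))
         < ((pos y * s (den x)) + (neg x * s (den y)))

  Subset : Set₁
  Subset = QM → Set

  IsOpen : Subset → Set
  IsOpen U = ∀ x → U x →
      (∀ y → U y)
    ⊎ (Σ QM λ a → a <Q x × (∀ y → a <Q y → U y))
    ⊎ (Σ QM λ b → x <Q b × (∀ y → y <Q b → U y))
    ⊎ (Σ QM λ a → Σ QM λ b → a <Q x × x <Q b × (∀ y → a <Q y → y <Q b → U y))

  CountableSubset : Subset → Set
  CountableSubset D = Countable (Σ QM D) (λ u v → proj₁ u ≈Q proj₁ v)

  UncountableSubset : Subset → Set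
  UncountableSubset D = ¬ CountableSubset D

  Dense : Subset → Set₁
  Dense D = ∀ (U : Subset) → IsOpen U → Σ QM U → Σ QM λ x → U x × D x

  Separable : Set₁
  Separable = Σ Subset λ D → CountableSubset D × Dense D

  Discrete : Subset → Set₁
  Discrete S = ∀ x → S x →
    Σ Subset λ U → IsOpen U × U x × (∀ y → U y → S y → y ≈Q x)

  IntervalFamily : Set₁
  IntervalFamily = QM × QM → Set

  NonemptyIntervals : IntervalFamily → Set
  NonemptyIntervals F = ∀ a b → F (a , b) → Σ QM λ x → a <Q x × x <Q b

  PairwiseDisjoint : IntervalFamily → Set
  PairwiseDisjoint F = ∀ a b a' b' → F (a , b) → F (a' , b') →
      (a ≈Q a' × b ≈Q b')
    ⊎ (∀ x → a <Q x → x <Q b → a' <Q x → x <Q b' → ⊥)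

  UncountableFamily : IntervalFamily → Set
  UncountableFamily F =
    Uncountable (Σ (QM × QM) F)
      (λ u v → (proj₁ (proj₁ u) ≈Q proj₁ (proj₁ v)) × (proj₂ (proj₁ u) ≈Q proj₂ (proj₁ v)))

module Submission where

-- Inside M, the unit intervals I_a = (a , a + 1) of ℚ^M,
-- one for each a ∈ M, are nonempty (they contain (2a + 1)/2), open, and
-- pairwise disjoint: a rational lying in I_a and in I_b forces a = b,
-- since a < b would give x < a + 1 ≤ b < x.  Since M is uncountable, this
-- family of intervals is uncountable, and all three claims follow:
-- a countable dense set would have to meet every I_a, giving an injection
-- M → ℕ; the midpoints of the I_a form an uncountable discrete set; and the
-- I_a themselves are the required family of disjoint intervals.

open import Defs
open import Data.Product using (Σ; _×_; _,_; proj₁; proj₂)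
open import Data.Sum using (_⊎_; inj₁; inj₂)
open import Data.Empty using (⊥; ⊥-elim)
open import Function using (_∘_)
open import Relation.Nullary using (¬_; yes; no)
open import Relation.Binary.Definitions using (DecidableEquality)
open import Relation.Binary.PropositionalEquality
open import Algebra.Bundles using (CommutativeSemiring)
open import Algebra.Structures using (IsCommutativeMonoid)
open import Algebra.Structures.Biased using (IsCommutativeSemiringˡ)

uncountable-by-injection : {A B : Set} {_≈_ : B → B → Set} →
  Uncountable A _≡_ → (g : A → B) → (∀ a a' → g a ≈ g a' → a ≡ a') →
  Uncountable B _≈_
uncountable-by-injection unc g g-inj (f , f-inj) =
  unc (f ∘ g , λ a a' e → g-inj a a' (f-inj _ _ e))

module OrderTopology (M : Structure) where

  Between : QM M → QM M → Subset M
  Between l r x = _<Q_ M l x × _<Q_ M x r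

  between-open : ∀ l r → IsOpen M (Between l r)
  between-open l r x (l<x , x<r) =
    inj₂ (inj₂ (inj₂ (l , r , l<x , x<r , λ y l<y y<r → l<y , y<r)))

  record DisjointIntervals (I : Set) : Set where
    field
      left right centre : I → QM M
      centre-inside     : ∀ i → Between (left i) (right i) (centre i)
      disjoint          : ∀ i j x y → Between (left i) (right i) x →
                          Between (left j) (right j) y → _≈Q_ M x y → i ≡ j
      left-injective    : ∀ i j → _≈Q_ M (left i) (left j) → i ≡ j

    Interval : I → Subset M
    Interval i = Between (left i) (right i)

  module _ {I : Set} (D : DisjointIntervals I) where
    open DisjointIntervals D

    -- A dense set meets every interval of the family, so choosing a point in
    -- each one injects I into the dense set; hence it cannot be countable.
    not-separable : Uncountable I _≡_ → ¬ Separable M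
    not-separable unc (S , S-countable , S-dense) =
      uncountable-by-injection unc pick pick-injective S-countable
      where
      hit : ∀ i → Σ (QM M) λ x → Interval i x × S x
      hit i = S-dense (Interval i) (between-open _ _) (centre i , centre-inside i)
      pick : I → Σ (QM M) S
      pick i = proj₁ (hit i) , proj₂ (proj₂ (hit i))
      pick-injective : ∀ i j → _≈Q_ M (proj₁ (pick i)) (proj₁ (pick j)) → i ≡ j
      pick-injective i j = disjoint i j _ _ (proj₁ (proj₂ (hit i))) (proj₁ (proj₂ (hit j)))

    Centres : Subset M
    Centres x = Σ I λ i → x ≡ centre i

    centres-uncountable : Uncountable I _≡_ → UncountableSubset M Centres
    centres-uncountable unc = uncountable-by-injection unc (λ i → centre i , i , refl)
      λ i j → disjoint i j _ _ (centre-inside i) (centre-inside j)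

    -- each centre is isolated by its own interval, which contains no other centre
    centres-discrete : Discrete M Centres
    centres-discrete x (i , refl) =
      Interval i , between-open _ _ , centre-inside i , isolated
      where
      isolated : ∀ y → Interval i y → Centres y → _≈Q_ M y (centre i)
      isolated y y∈Iᵢ (j , refl) with disjoint i j y y y∈Iᵢ (centre-inside j) refl
      ... | refl = refl

    Intervals : IntervalFamily M
    Intervals (l , r) = Σ I λ i → l ≡ left i × r ≡ right i

    intervals-uncountable : Uncountable I _≡_ → UncountableFamily M Intervals
    intervals-uncountable unc =
      uncountable-by-injection unc (λ i → (left i , right i) , i , refl , refl)
        λ i j → left-injective i j ∘ proj₁

    intervals-nonempty : NonemptyIntervals M Intervals
    intervals-nonempty _ _ (i , refl , refl) = centre i , centre-inside i

    -- disjointness needs to decide whether two indices coincide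
    intervals-disjoint : DecidableEquality I → PairwiseDisjoint M Intervals
    intervals-disjoint _≟_ _ _ _ _ (i , refl , refl) (j , refl , refl) with i ≟ j
    ... | yes refl = inj₁ (refl , refl)
    ... | no i≢j = inj₂ λ x l<x x<r l'<x x<r' →
      i≢j (disjoint i j x x (l<x , x<r) (l'<x , x<r') refl)

-- Arithmetic in a model of PA.  Each law is an instance of the induction
-- schema for an explicit formula; variable 0 is the induction variable and
-- variables 1, 2 are the parameters.
module PAArithmetic (M : Structure) (P : IsPAModel M) where
  open Structure M hiding (_+_; _*_)
  open IsPAModel P
  infixl 6 _+_
  infixl 7 _*_
  _+_ _*_ : Carrier → Carrier → Carrier
  _+_ = Structure._+_ M
  _*_ = Structure._*_ M

  params₀ : Env M
  params₀ _ = z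

  params₁ : Carrier → Env M
  params₁ x = _∷ₑ_ M x params₀

  params₂ : Carrier → Carrier → Env M
  params₂ x y = _∷ₑ_ M x (params₁ y)

  x₀ x₁ x₂ : Term
  x₀ = var 0
  x₁ = var 1
  x₂ = var 2

  open ≡-Reasoning

  +-identityˡ : ∀ x → z + x ≡ x
  +-identityˡ = induction ((zer ⊕ x₀) ≐ x₀) params₀ (+-z z)
    λ a ih → trans (+-s z a) (cong s ih)

  +-sucˡ : ∀ x y → s x + y ≡ s (x + y)
  +-sucˡ x = induction ((succ x₁ ⊕ x₀) ≐ succ (x₁ ⊕ x₀)) (params₁ x)
    (trans (+-z (s x)) (cong s (sym (+-z x))))
    λ a ih → trans (+-s (s x) a) (trans (cong s ih) (cong s (sym (+-s x a))))

  +-comm : ∀ x y → x + y ≡ y + x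
  +-comm x = induction ((x₁ ⊕ x₀) ≐ (x₀ ⊕ x₁)) (params₁ x)
    (trans (+-z x) (sym (+-identityˡ x)))
    λ a ih → trans (+-s x a) (trans (cong s ih) (sym (+-sucˡ a x)))

  +-assoc : ∀ x y w → (x + y) + w ≡ x + (y + w)
  +-assoc x y = induction (((x₁ ⊕ x₂) ⊕ x₀) ≐ (x₁ ⊕ (x₂ ⊕ x₀))) (params₂ x y)
    (trans (+-z (x + y)) (cong (x +_) (sym (+-z y))))
    λ a ih → begin
      (x + y) + s a ≡⟨ +-s (x + y) a ⟩
      s ((x + y) + a) ≡⟨ cong s ih ⟩
      s (x + (y + a)) ≡⟨ sym (+-s x (y + a)) ⟩
      x + s (y + a) ≡⟨ cong (x +_) (sym (+-s y a)) ⟩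
      x + (y + s a) ∎

  *-zeroˡ : ∀ x → z * x ≡ z
  *-zeroˡ = induction ((zer ⊗ x₀) ≐ zer) params₀ (*-z z)
    λ a ih → trans (*-s z a) (trans (+-z _) ih)

  *-sucˡ : ∀ x y → s x * y ≡ x * y + y
  *-sucˡ x = induction ((succ x₁ ⊗ x₀) ≐ ((x₁ ⊗ x₀) ⊕ x₀)) (params₁ x)
    (trans (*-z (s x)) (trans (sym (+-z z)) (cong (_+ z) (sym (*-z x)))))
    λ a ih → begin
      s x * s a ≡⟨ *-s (s x) a ⟩
      s x * a + s x ≡⟨ cong (_+ s x) ih ⟩
      (x * a + a) + s x ≡⟨ +-assoc _ _ _ ⟩
      x * a + (a + s x) ≡⟨ cong (x * a +_) (swap-suc a) ⟩
      x * a + (x + s a) ≡⟨ sym (+-assoc _ _ _) ⟩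
      (x * a + x) + s a ≡⟨ cong (_+ s a) (sym (*-s x a)) ⟩
      x * s a + s a ∎
    where
    swap-suc : ∀ a → a + s x ≡ x + s a
    swap-suc a = trans (+-s a x) (trans (cong s (+-comm a x)) (sym (+-s x a)))

  *-comm : ∀ x y → x * y ≡ y * x
  *-comm x = induction ((x₁ ⊗ x₀) ≐ (x₀ ⊗ x₁)) (params₁ x)
    (trans (*-z x) (sym (*-zeroˡ x)))
    λ a ih → trans (*-s x a) (trans (cong (_+ x) ih) (sym (*-sucˡ a x)))

  *-distribˡ-+ : ∀ x y w → x * (y + w) ≡ x * y + x * w
  *-distribˡ-+ x y = induction ((x₁ ⊗ (x₂ ⊕ x₀)) ≐ ((x₁ ⊗ x₂) ⊕ (x₁ ⊗ x₀))) (params₂ x y)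
    (trans (cong (x *_) (+-z y)) (trans (sym (+-z (x * y))) (cong (x * y +_) (sym (*-z x)))))
    λ a ih → begin
      x * (y + s a) ≡⟨ cong (x *_) (+-s y a) ⟩
      x * s (y + a) ≡⟨ *-s x _ ⟩
      x * (y + a) + x ≡⟨ cong (_+ x) ih ⟩
      (x * y + x * a) + x ≡⟨ +-assoc _ _ _ ⟩
      x * y + (x * a + x) ≡⟨ cong (x * y +_) (sym (*-s x a)) ⟩
      x * y + x * s a ∎

  *-distribʳ-+ : ∀ x y w → (y + w) * x ≡ y * x + w * x
  *-distribʳ-+ x y w = begin
    (y + w) * x ≡⟨ *-comm (y + w) x ⟩
    x * (y + w) ≡⟨ *-distribˡ-+ x y w ⟩
    x * y + x * w ≡⟨ cong₂ _+_ (*-comm x y) (*-comm x w) ⟩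
    y * x + w * x ∎

  *-assoc : ∀ x y w → (x * y) * w ≡ x * (y * w)
  *-assoc x y = induction (((x₁ ⊗ x₂) ⊗ x₀) ≐ (x₁ ⊗ (x₂ ⊗ x₀))) (params₂ x y)
    (trans (*-z (x * y)) (trans (sym (*-z x)) (cong (x *_) (sym (*-z y)))))
    λ a ih → begin
      (x * y) * s a ≡⟨ *-s (x * y) a ⟩
      (x * y) * a + x * y ≡⟨ cong (_+ x * y) ih ⟩
      x * (y * a) + x * y ≡⟨ sym (*-distribˡ-+ x (y * a) y) ⟩
      x * (y * a + y) ≡⟨ cong (x *_) (sym (*-s y a)) ⟩
      x * (y * s a) ∎

  *-identityʳ : ∀ x → x * s z ≡ x
  *-identityʳ x = trans (*-s x z) (trans (cong (_+ x) (*-z x)) (+-identityˡ x))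

  commutativeSemiring : CommutativeSemiring _ _
  commutativeSemiring = record
    { Carrier = Carrier ; _≈_ = _≡_ ; _+_ = _+_ ; _*_ = _*_ ; 0# = z ; 1# = s z
    ; isCommutativeSemiring = IsCommutativeSemiringˡ.isCommutativeSemiring record
        { +-isCommutativeMonoid = +-isCommutativeMonoid
        ; *-isCommutativeMonoid = *-isCommutativeMonoid
        ; distribʳ = *-distribʳ-+
        ; zeroˡ = *-zeroˡ } }
    where
    +-isCommutativeMonoid : IsCommutativeMonoid _≡_ _+_ z
    +-isCommutativeMonoid = record
      { isMonoid = record
        { isSemigroup = record
          { isMagma = record { isEquivalence = isEquivalence ; ∙-cong = cong₂ _+_ }
          ; assoc = +-assoc }
        ; identity = +-identityˡ , +-z }
      ; comm = +-comm }
    *-isCommutativeMonoid : IsCommutativeMonoid _≡_ _*_ (s z)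
    *-isCommutativeMonoid = record
      { isMonoid = record
        { isSemigroup = record
          { isMagma = record { isEquivalence = isEquivalence ; ∙-cong = cong₂ _*_ }
          ; assoc = *-assoc }
        ; identity = (λ x → trans (*-comm (s z) x) (*-identityʳ x)) , *-identityʳ }
      ; comm = *-comm }

  _≺ᴹ_ : Carrier → Carrier → Set
  x ≺ᴹ y = Σ Carrier λ w → x + s w ≡ y

  zero-or-suc : ∀ y → y ≡ z ⊎ Σ Carrier λ w → y ≡ s w
  zero-or-suc = induction ((x₀ ≐ zer) ∨' ∃' (x₁ ≐ succ x₀)) params₀
    (inj₁ refl) (λ a _ → inj₂ (a , refl))

  +-suc-irrefl : ∀ w x → x + s w ≡ x → ⊥
  +-suc-irrefl w = induction (((x₀ ⊕ succ x₁) ≐ x₀) ⇒' ⊥') (params₁ w)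
    (λ eq → s≢z (z + w) (trans (sym (+-s z w)) eq))
    λ a ih eq → ih (s-inj _ _ (trans (sym (+-sucˡ a (s w))) eq))

  Trichotomous : Carrier → Carrier → Set
  Trichotomous x y = x ≡ y ⊎ x ≺ᴹ y ⊎ y ≺ᴹ x

  -- trichotomy, by induction on x with y universally quantified in the formula
  trichotomy : ∀ x y → Trichotomous x y
  trichotomy = induction
    (∀' ((x₁ ≐ x₀) ∨' (∃' ((x₂ ⊕ succ x₀) ≐ x₁) ∨' ∃' ((x₁ ⊕ succ x₀) ≐ x₂))))
    params₀ base step
    where
    base : ∀ y → Trichotomous z y
    base y with zero-or-suc y
    ... | inj₁ refl = inj₁ refl
    ... | inj₂ (w , refl) = inj₂ (inj₁ (w , +-identityˡ (s w)))
    a+1≡sa : ∀ a → a + s z ≡ s a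
    a+1≡sa a = trans (+-s a z) (cong s (+-z a))
    step : ∀ a → (∀ y → Trichotomous a y) → ∀ y → Trichotomous (s a) y
    step a ih y with ih y
    ... | inj₁ refl = inj₂ (inj₂ (z , a+1≡sa a))
    ... | inj₂ (inj₂ (w , eq)) = inj₂ (inj₂ (s w , trans (+-s y (s w)) (cong s eq)))
    ... | inj₂ (inj₁ (w , eq)) with zero-or-suc w
    ... | inj₁ refl = inj₁ (trans (sym (a+1≡sa a)) eq)
    ... | inj₂ (w' , refl) =
      inj₂ (inj₁ (w' , trans (+-sucˡ a (s w')) (trans (sym (+-s a (s w'))) eq)))

  _≟_ : DecidableEquality Carrier
  x ≟ y with trichotomy x y
  ... | inj₁ x≡y = yes x≡y
  ... | inj₂ (inj₁ (w , eq)) = no λ where refl → +-suc-irrefl w x eq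
  ... | inj₂ (inj₂ (w , eq)) = no λ where refl → +-suc-irrefl w x eq

module UnitIntervals (M : Structure) (P : IsPAModel M) where
  open Structure M hiding (_+_; _*_)
  open IsPAModel P
  open PAArithmetic M P
  open OrderTopology M
  open import Algebra.Solver.Ring.NaturalCoefficients.Default commutativeSemiring
  open ≡-Reasoning

  -- the rationals a/1, (a + 1)/1 and (2a + 1)/2
  left right centre : Carrier → QM M
  left a = frac a z z
  right a = frac (s a) z z
  centre a = frac (s (a + a)) z (s z)

  s≡+1 : ∀ x → s x ≡ x + s z
  s≡+1 x = sym (trans (+-s x z) (cong s (+-z x)))

  centre-inside : ∀ a → Between (left a) (right a) (centre a)
  centre-inside a = <-def₂ _ _ z lower , <-def₂ _ _ z upper
    where
    lower : a * s (s z) + z * s z + s z ≡ s (a + a) * s z + z * s (s z)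
    lower = begin
      a * s (s z) + z * s z + s z
        ≡⟨ cong (λ t → a * t + z * s z + s z) (s≡+1 (s z)) ⟩
      a * (s z + s z) + z * s z + s z
        ≡⟨ solve 1 (λ a → a :* (con 1 :+ con 1) :+ con 0 :* con 1 :+ con 1
                        := (a :+ a :+ con 1) :* con 1 :+ con 0 :* (con 1 :+ con 1)) refl a ⟩
      (a + a + s z) * s z + z * (s z + s z)
        ≡⟨ cong₂ (λ t u → t * s z + z * u) (sym (s≡+1 (a + a))) (sym (s≡+1 (s z))) ⟩
      s (a + a) * s z + z * s (s z) ∎
    upper : s (a + a) * s z + z * s (s z) + s z ≡ s a * s (s z) + z * s z
    upper = begin
      s (a + a) * s z + z * s (s z) + s z
        ≡⟨ cong₂ (λ t u → t * s z + z * u + s z) (s≡+1 (a + a)) (s≡+1 (s z)) ⟩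
      (a + a + s z) * s z + z * (s z + s z) + s z
        ≡⟨ solve 1 (λ a → (a :+ a :+ con 1) :* con 1 :+ con 0 :* (con 1 :+ con 1) :+ con 1
                        := (a :+ con 1) :* (con 1 :+ con 1) :+ con 0 :* con 1) refl a ⟩
      (a + s z) * (s z + s z) + z * s z
        ≡⟨ cong₂ (λ t u → t * u + z * s z) (sym (s≡+1 a)) (sym (s≡+1 (s z))) ⟩
      s a * s (s z) + z * s z ∎

  left-injective : ∀ a b → _≈Q_ M (left a) (left b) → a ≡ b
  left-injective a b eq = begin
    a                 ≡⟨ solve 1 (λ a → a := a :* con 1 :+ con 0 :* con 1) refl a ⟩
    a * s z + z * s z ≡⟨ eq ⟩
    b * s z + z * s z ≡⟨ solve 1 (λ a → a :* con 1 :+ con 0 :* con 1 := a) refl b ⟩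
    b                 ∎

  -- If a < b then no x < a + 1 equals any x' > b: writing x = (p − m)/D and
  -- x' = (p' − m')/D', the two strict inequalities and x = x' add up to an
  -- equation X + (k + 1) = X in M.
  separated : ∀ a b x x' → _<Q_ M x (right a) → _<Q_ M (left b) x' →
              _≈Q_ M x x' → a ≺ᴹ b → ⊥
  separated a b (frac p m d) (frac p' m' d') x<a+1 b<x' x≈x' (w , a+1+w≡b) =
    +-suc-irrefl k X (trans (cong (X +_) (sym gap≡sk)) X+gap≡X)
    where
    D D' V U X k gap : Carrier
    D = s d
    D' = s d'
    V = s (proj₁ (<-def₁ _ _ x<a+1))
    U = s (proj₁ (<-def₁ _ _ b<x'))
    X = s a * D * D' + m * D' + m' * D
    k = w * D' * D + U * D + (V * d' + proj₁ (<-def₁ _ _ x<a+1))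
    gap = w * D' * D + U * D + V * D'
    x-below : p * s z + z * D + V ≡ s a * D + m * s z
    x-below = proj₂ (<-def₁ _ _ x<a+1)
    x'-above : b * D' + m' * s z + U ≡ p' * s z + z * D'
    x'-above = proj₂ (<-def₁ _ _ b<x')
    gap≡sk : gap ≡ s k
    gap≡sk = trans (cong (w * D' * D + U * D +_) (trans (*-s V d') (+-s _ _))) (+-s _ _)
    sa+w≡b : s a + w ≡ b
    sa+w≡b = trans (+-sucˡ a w) (trans (sym (+-s a w)) a+1+w≡b)
    X+gap≡X : X + gap ≡ X
    X+gap≡X = begin
      X + gap
        ≡⟨ solve 8 (λ SA w D D' m m' U V →
             SA :* D :* D' :+ m :* D' :+ m' :* D :+ (w :* D' :* D :+ U :* D :+ V :* D')
             := (SA :+ w) :* D' :* D :+ m' :* con 1 :* D :+ U :* D :+ m :* D' :+ V :* D')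
             refl (s a) w D D' m m' U V ⟩
      (s a + w) * D' * D + m' * s z * D + U * D + m * D' + V * D'
        ≡⟨ cong (λ t → t * D' * D + m' * s z * D + U * D + m * D' + V * D') sa+w≡b ⟩
      b * D' * D + m' * s z * D + U * D + m * D' + V * D'
        ≡⟨ solve 7 (λ b D D' m m' U V →
             b :* D' :* D :+ m' :* con 1 :* D :+ U :* D :+ m :* D' :+ V :* D'
             := (b :* D' :+ m' :* con 1 :+ U) :* D :+ m :* D' :+ V :* D')
             refl b D D' m m' U V ⟩
      (b * D' + m' * s z + U) * D + m * D' + V * D'
        ≡⟨ cong (λ t → t * D + m * D' + V * D') x'-above ⟩
      (p' * s z + z * D') * D + m * D' + V * D'
        ≡⟨ solve 5 (λ p' D D' m V →
             (p' :* con 1 :+ con 0 :* D') :* D :+ m :* D' :+ V :* D'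
             := p' :* D :+ m :* D' :+ V :* D') refl p' D D' m V ⟩
      p' * D + m * D' + V * D'
        ≡⟨ cong (_+ V * D') (sym x≈x') ⟩
      p * D' + m' * D + V * D'
        ≡⟨ solve 5 (λ p D D' m' V →
             p :* D' :+ m' :* D :+ V :* D'
             := (p :* con 1 :+ con 0 :* D :+ V) :* D' :+ m' :* D) refl p D D' m' V ⟩
      (p * s z + z * D + V) * D' + m' * D
        ≡⟨ cong (λ t → t * D' + m' * D) x-below ⟩
      (s a * D + m * s z) * D' + m' * D
        ≡⟨ solve 5 (λ SA D D' m m' →
             (SA :* D :+ m :* con 1) :* D' :+ m' :* D
             := SA :* D :* D' :+ m :* D' :+ m' :* D) refl (s a) D D' m m' ⟩
      X ∎

  disjoint : ∀ a b x x' → Between (left a) (right a) x →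
             Between (left b) (right b) x' → _≈Q_ M x x' → a ≡ b
  disjoint a b x x' (a<x , x<a+1) (b<x' , x'<b+1) x≈x' with trichotomy a b
  ... | inj₁ a≡b = a≡b
  ... | inj₂ (inj₁ a≺b) = ⊥-elim (separated a b x x' x<a+1 b<x' x≈x' a≺b)
  ... | inj₂ (inj₂ b≺a) = ⊥-elim (separated b a x' x x'<b+1 a<x (sym x≈x') b≺a)

  unitIntervals : DisjointIntervals Carrier
  unitIntervals = record
    { left = left ; right = right ; centre = centre
    ; centre-inside = centre-inside
    ; disjoint = disjoint
    ; left-injective = left-injective }

mainTheorem5 : (M : Structure) → IsPAModel M →
    Uncountable (Structure.Carrier M) _≡_ →
    ¬ Separable M
    × (Σ (Subset M) λ S → UncountableSubset M S × Discrete M S)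
    × (Σ (IntervalFamily M) λ F →
    UncountableFamily M F × NonemptyIntervals M F × PairwiseDisjoint M F)
mainTheorem5 M P unc =
    not-separable I unc
  , (Centres I , centres-uncountable I unc , centres-discrete I)
  , (Intervals I , intervals-uncountable I unc , intervals-nonempty I
    , intervals-disjoint I (PAArithmetic._≟_ M P))
  where
  open OrderTopology M
  I : DisjointIntervals (Structure.Carrier M)
  I = UnitIntervals.unitIntervals M P
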